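{- Let $q$ be an odd prime power and $n$ a positive integer. If a set $A\subseteq \mathbb{F}_q^n$ does not contain a right angle, i.e. there are no three distinct vectors $x,y,z\in A$ with $\langle x-z,y-z\rangle=0$, then $$|A|\leq 4(q-1)q\binom{n+q-2}{q-2}+2q.$$
   Context: $\langle u,v\rangle=\sum_{i=1}^n u_iv_i$ denotes the standard dot product on $\mathbb{F}_q^n$. -}

module Defs where

open import Level using (Level)
open import Data.Nat using (ℕ; zero; suc; _^_; _<_)
open import Data.Nat.Primality using (Prime)
open import Data.Fin using (Fin) renaming (zero to fzero; suc to fsuc)
open import Data.List using (List; length)
open import Data.List.Relation.Unary.Any using (Any)
open import Data.List.Relation.Unary.AllPairs using (AllPairs)
open import Data.Product using (Σ; ∃; ∃-syntax; _×_)
open import Relation.Nullary using (¬_)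
open import Relation.Binary.PropositionalEquality using (_≡_)
open import Algebra.Bundles using (CommutativeRing)

IsPrimePower : ℕ → Set
IsPrimePower q = ∃[ p ] ∃[ k ] (Prime p × 0 < k × q ≡ p ^ k)

module _ {c ℓ : Level} (R : CommutativeRing c ℓ) where
  open CommutativeRing R

  IsField : Set (c Level.⊔ ℓ)
  IsField = (¬ 0# ≈ 1#) × (∀ x → ¬ x ≈ 0# → ∃[ y ] (x * y ≈ 1#))

  HasCard : ℕ → Set (c Level.⊔ ℓ)
  HasCard q = Σ (List Carrier) λ xs →
    length xs ≡ q × AllPairs (λ a b → ¬ a ≈ b) xs × (∀ x → Any (x ≈_) xs)

  Vect : ℕ → Set c
  Vect n = Fin n → Carrier

  _≈ᵥ_ : ∀ {n} → Vect n → Vect n → Set ℓ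
  u ≈ᵥ v = ∀ i → u i ≈ v i

  _-ᵥ_ : ∀ {n} → Vect n → Vect n → Vect n
  (u -ᵥ v) i = u i - v i

  dot : ∀ {n} → Vect n → Vect n → Carrier
  dot {zero}  u v = 0#
  dot {suc n} u v = u fzero * v fzero + dot {n} (λ i → u (fsuc i)) (λ i → v (fsuc i))

-- Fix z ∈ A and sort the points x of A by the value of ‖x − z‖².  For a level
-- a ≠ 0, attach to each point xᵢ of the level the polynomial
--   fᵢ(y) = ∏_{s ∉ {0, a}} (⟨xᵢ − z, y − z⟩ − s)
-- of degree q − 2.  As A has no right angle, ⟨xᵢ − z, xⱼ − z⟩ ∉ {0, a} for i ≠ j,
-- so fᵢ(xⱼ) = 0 while fᵢ(xᵢ) ≠ 0; the fᵢ are therefore linearly independent in the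
-- space of polynomials of degree ≤ q − 2, whose dimension is C(n + q − 2, q − 2).
-- On the level a = 0 pick z′ ≠ z: every other x satisfies
--   ‖x − z′‖² = −2⟨x − z, z′ − z⟩ ≠ 0
-- (q is odd), so it lies on a level ≠ 0 around z′.  Hence
-- |A| ≤ q (2 + q C(n + q − 2, q − 2)), which is at most the claimed bound.
module Submission where

open import Defs
open import Level using (Level; _⊔_)
open import Function using (id; _∘_; flip)
open import Data.Product using (∃-syntax; _×_; _,_; proj₁; proj₂)
open import Data.Nat as ℕ
  using (ℕ; zero; suc; _^_; _∸_; _≤_; _<_; _≤′_; _%_; z≤n; s≤s; ≤′-refl; ≤′-step;
         NonZero; >-nonZero; nonTrivial⇒n>1)
open import Data.Nat.Properties
  using (≤-refl; ≤-trans; ≤-reflexive; ≤-antisym; +-suc; +-comm; +-mono-≤; +-monoˡ-≤; +-monoʳ-≤;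
         *-monoˡ-≤; +-∸-assoc; ∸-monoˡ-≤; m≤n+m; m≤n*m; m≤m*n; m≤n⇒m≤1+n; m^n≢0;
         suc-injective; ≤⇒≤′; module ≤-Reasoning)
open import Data.Nat.DivMod using (m*n%n≡0)
open import Data.Nat.Primality using (prime⇒nonTrivial; prime⇒nonZero)
open import Data.Nat.Combinatorics using (_C_; nCn≡1; nCk+nC[k+1]≡[n+1]C[k+1])
open import Data.Nat.Tactic.RingSolver using (solve-∀)
open import Data.Fin using (Fin; punchIn; splitAt) renaming (zero to fzero; suc to fsuc)
open import Data.Fin.Properties using (any?; all?; punchIn-injective; punchInᵢ≢i)
open import Data.Sum.Properties using ([,]-map)
open import Data.Vec.Functional using (Vector; _++_; tail)
open import Data.Vec.Functional.Relation.Binary.Equality.Setoid using (≋-setoid)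
open import Data.List using (List; []; _∷_; length; filter; lookup)
open import Data.List.Properties using (filter-notAll; filter-some; filter-none)
open import Data.List.Relation.Unary.Any as Any using (Any; here; there)
open import Data.List.Relation.Unary.All as All using (All; []; _∷_)
open import Data.List.Relation.Unary.All.Properties
  using (all-filter; ¬Any⇒All¬) renaming (filter⁺ to All-filter⁺)
open import Data.List.Relation.Unary.AllPairs using (AllPairs; []; _∷_)
import Data.List.Relation.Unary.AllPairs.Properties as AllPairs
open import Data.List.Relation.Unary.Unique.Setoid.Properties as Unique using (Unique[x∷xs]⇒x∉xs)
open import Data.List.Membership.Propositional using (_∈_; find)
open import Data.List.Membership.Propositional.Properties using (∈-filter⁻; ∈-lookup)
import Data.List.Membership.Setoid as SetoidMembership
open import Data.List.Membership.Setoid.Properties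
  using (∈-resp-≈; ∈-length; ∈-filter⁺) renaming (∈-filter⁻ to ∈ₛ-filter⁻)
open import Data.List.Relation.Binary.Sublist.Propositional.Properties as Sublist
  using (filter-⊆; length-mono-≤)
open import Relation.Nullary using (¬_; Dec; yes; no; ¬?)
open import Relation.Nullary.Decidable using (decidable-stable)
open import Relation.Nullary.Negation using (contradiction)
open import Relation.Unary using (Pred; Decidable)
open import Relation.Unary.Properties using (∁?)
open import Relation.Binary.PropositionalEquality as ≡ using (_≡_; _≢_; _≗_)
open import Relation.Binary.Bundles using (Setoid)
import Relation.Binary.Reasoning.Setoid as SetoidReasoning
open import Algebra.Bundles using (CommutativeRing)

tail-++ : ∀ {a m n} {A : Set a} (u : Vector A (suc m)) (u′ : Vector A n) → tail (u ++ u′) ≗ tail u ++ u′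
tail-++ {m = m} u u′ i = [,]-map (splitAt m i)

allPairs-lookup : ∀ {a r} {A : Set a} {R : A → A → Set r} → (∀ {x y} → R x y → R y x) →
                  ∀ {xs : List A} → AllPairs R xs → ∀ i j → i ≢ j → R (lookup xs i) (lookup xs j)
allPairs-lookup R-sym (_ ∷ _)      fzero    fzero    i≢j = contradiction ≡.refl i≢j
allPairs-lookup R-sym (Rx ∷ _)     fzero    (fsuc j) _   = All.lookup Rx (∈-lookup j)
allPairs-lookup R-sym (Rx ∷ _)     (fsuc i) fzero    _   = R-sym (All.lookup Rx (∈-lookup i))
allPairs-lookup R-sym (_ ∷ unique) (fsuc i) (fsuc j) i≢j =
  allPairs-lookup R-sym unique i j (i≢j ∘ ≡.cong fsuc)

module _ {a p} {A : Set a} {P : Pred A p} (P? : Decidable P) where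
  open import Data.Nat using (_+_)

  length-filter-∁ : ∀ xs → length xs ≡ length (filter P? xs) + length (filter (∁? P?) xs)
  length-filter-∁ []       = ≡.refl
  length-filter-∁ (x ∷ xs) with P? x
  ... | yes _ = ≡.cong suc (length-filter-∁ xs)
  ... | no _  = ≡.trans (≡.cong suc (length-filter-∁ xs)) (≡.sym (+-suc _ _))

module _ {a i p} {A : Set a} {I : Set i} {P : I → Pred A p} (P? : ∀ c → Decidable (P c)) where
  open import Data.Nat using (_+_; _*_)

  length≤cover : ∀ (cs : List I) xs {M} → (∀ {x} → x ∈ xs → Any (λ c → P c x) cs) →
                 (∀ c → length (filter (P? c) xs) ≤ M) → length xs ≤ length cs * M
  length≤cover []       []      cover bound = z≤n
  length≤cover []       (x ∷ _) cover bound with () ← cover (here ≡.refl)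
  length≤cover (c ∷ cs) xs {M} cover bound = begin
    length xs                                ≡⟨ length-filter-∁ (P? c) xs ⟩
    length (filter (P? c) xs) + length rest  ≤⟨ +-mono-≤ (bound c) (length≤cover cs rest rest-cover rest-bound) ⟩
    M + length cs * M                        ∎
    where
    open ≤-Reasoning
    rest = filter (∁? (P? c)) xs
    rest-cover : ∀ {x} → x ∈ rest → Any (λ c → P c x) cs
    rest-cover x∈rest with x∈xs , ¬Pcx ← ∈-filter⁻ (∁? (P? c)) x∈rest with cover x∈xs
    ... | here Pcx   = contradiction Pcx ¬Pcx
    ... | there Pc′x = Pc′x
    rest-bound : ∀ d → length (filter (P? d) rest) ≤ M
    rest-bound d = ≤-trans
      (length-mono-≤ (Sublist.filter⁺ (P? d) (P? d) (λ { ≡.refl → id }) (filter-⊆ (∁? (P? c)) xs)))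
      (bound d)

module _ {a ℓ} (S : Setoid a ℓ) where
  open Setoid S renaming (refl to ≈-refl)
  open SetoidMembership S using () renaming (_∈_ to _∈ₛ_)
  open import Data.Nat using (_+_; _*_)

  length≤1 : ∀ {c xs} → AllPairs _≉_ xs → All (_≈ c) xs → length xs ≤ 1
  length≤1 []              []              = z≤n
  length≤1 (_ ∷ [])        (_ ∷ [])        = s≤s z≤n
  length≤1 ((x≉y ∷ _) ∷ _) (x≈c ∷ y≈c ∷ _) = contradiction (trans x≈c (sym y≈c)) x≉y

  enumeration⇒decidable : ∀ {xs} → AllPairs _≉_ xs → (∀ x → x ∈ₛ xs) → ∀ x y → Dec (x ≈ y)
  enumeration⇒decidable unique covers x y = go unique (covers x) (covers y)
    where
    go : ∀ {xs} → AllPairs _≉_ xs → x ∈ₛ xs → y ∈ₛ xs → Dec (x ≈ y)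
    go _       (here x≈h)  (here y≈h)  = yes (trans x≈h (sym y≈h))
    go u       (here x≈h)  (there y∈t) = no λ x≈y →
      Unique[x∷xs]⇒x∉xs S u (∈-resp-≈ S (trans (sym x≈y) x≈h) y∈t)
    go u       (there x∈t) (here y≈h)  = no λ x≈y →
      Unique[x∷xs]⇒x∉xs S u (∈-resp-≈ S (trans x≈y y≈h) x∈t)
    go (_ ∷ u) (there x∈t) (there y∈t) = go u x∈t y∈t

  module _ (_≟_ : ∀ x y → Dec (x ≈ y)) {σ : Carrier → Carrier} (σ-cong : ∀ {x y} → x ≈ y → σ x ≈ σ y)
           (σ-involutive : ∀ x → σ (σ x) ≈ x) (σ-fixpointFree : ∀ x → ¬ σ x ≈ x) where

    σ-Closed : List Carrier → Set (a ⊔ ℓ)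
    σ-Closed xs = ∀ {x} → x ∈ₛ xs → σ x ∈ₛ xs

    remove-σ-pair : ∀ {h t} → AllPairs _≉_ (h ∷ t) → σ-Closed (h ∷ t) →
                    ∃[ t′ ] length t ≡ suc (length t′) × AllPairs _≉_ t′ × σ-Closed t′
    remove-σ-pair {h} {t} unique@(_ ∷ t-unique) closed =
      filter (∁? (_≟ σ h)) t , length-t , Unique.filter⁺ S (∁? (_≟ σ h)) t-unique , closed′
      where
      σh∈t : σ h ∈ₛ t
      σh∈t with closed (here ≈-refl)
      ... | here σh≈h  = contradiction σh≈h (σ-fixpointFree h)
      ... | there σh∈t = σh∈t
      one-partner : length (filter (_≟ σ h) t) ≡ 1
      one-partner = ≤-antisym
        (length≤1 (Unique.filter⁺ S (_≟ σ h) t-unique) (all-filter (_≟ σ h) t))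
        (filter-some (_≟ σ h) (Any.map sym σh∈t))
      length-t : length t ≡ suc (length (filter (∁? (_≟ σ h)) t))
      length-t = ≡.trans (length-filter-∁ (_≟ σ h) t) (≡.cong₂ _+_ one-partner ≡.refl)
      ≉σh-resp : ∀ {x y} → x ≈ y → ¬ x ≈ σ h → ¬ y ≈ σ h
      ≉σh-resp x≈y x≉σh y≈σh = x≉σh (trans x≈y y≈σh)
      closed′ : σ-Closed (filter (∁? (_≟ σ h)) t)
      closed′ x∈t′ with x∈t , x≉σh ← ∈ₛ-filter⁻ S (∁? (_≟ σ h)) ≉σh-resp x∈t′
                   with closed (there x∈t)
      ... | here σx≈h  = contradiction (trans (sym (σ-involutive _)) (σ-cong σx≈h)) x≉σh
      ... | there σx∈t = ∈-filter⁺ S (∁? (_≟ σ h)) ≉σh-resp σx∈t λ σx≈σh →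
        Unique[x∷xs]⇒x∉xs S unique
          (∈-resp-≈ S (trans (sym (σ-involutive _)) (trans (σ-cong σx≈σh) (σ-involutive h))) x∈t)

    σ-closed⇒even : ∀ k xs → length xs ≡ k → AllPairs _≉_ xs → σ-Closed xs → ∃[ m ] k ≡ m * 2
    σ-closed⇒even _             []      ≡.refl _ _ = 0 , ≡.refl
    σ-closed⇒even zero          (h ∷ t) ()     _ _
    σ-closed⇒even (suc zero)    (h ∷ t) len≡ unique closed
      with t′ , length-t , _ ← remove-σ-pair unique closed =
      contradiction (≡.trans (≡.sym length-t) (suc-injective len≡)) λ ()
    σ-closed⇒even (suc (suc k)) (h ∷ t) len≡ unique closed
      with t′ , length-t , unique′ , closed′ ← remove-σ-pair unique closed
      with m , k≡m*2 ← σ-closed⇒even k t′ (suc-injective (≡.trans (≡.sym length-t) (suc-injective len≡)))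
                                        unique′ closed′
      = suc m , ≡.cong (2 +_) k≡m*2

polyDim : ℕ → ℕ → ℕ
polyDim zero    d       = 1
polyDim (suc n) zero    = 1
polyDim (suc n) (suc d) = polyDim n (suc d) ℕ.+ polyDim (suc n) d

polyDim≡C : ∀ n d → polyDim n d ≡ (n ℕ.+ d) C d
polyDim≡C zero    d       = ≡.sym (nCn≡1 d)
polyDim≡C (suc n) zero    = ≡.refl
polyDim≡C (suc n) (suc d) = begin
  polyDim n (suc d) ℕ.+ polyDim (suc n) d  ≡⟨ ≡.cong₂ ℕ._+_ (polyDim≡C n (suc d)) (polyDim≡C (suc n) d) ⟩
  m C suc d ℕ.+ suc (n ℕ.+ d) C d          ≡⟨ ≡.cong (λ k → m C suc d ℕ.+ k C d) (+-suc n d) ⟨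
  m C suc d ℕ.+ m C d                      ≡⟨ +-comm (m C suc d) (m C d) ⟩
  m C d ℕ.+ m C suc d                      ≡⟨ nCk+nC[k+1]≡[n+1]C[k+1] m d ⟩
  suc m C suc d                            ∎
  where
  open ≡.≡-Reasoning
  m = n ℕ.+ suc d

polyDim-suc : ∀ n d → polyDim n d ≤ polyDim n (suc d)
polyDim-suc zero    d       = ≤-refl
polyDim-suc (suc n) zero    = m≤n+m 1 (polyDim n 1)
polyDim-suc (suc n) (suc d) = m≤n+m (polyDim (suc n) (suc d)) (polyDim n (suc (suc d)))

polyDim-mono : ∀ n {d e} → d ≤ e → polyDim n d ≤ polyDim n e
polyDim-mono n = mono ∘ ≤⇒≤′
  where
  mono : ∀ {d e} → d ≤′ e → polyDim n d ≤ polyDim n e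
  mono ≤′-refl        = ≤-refl
  mono (≤′-step d≤′e) = ≤-trans (mono d≤′e) (polyDim-suc n _)

module Vectors {c ℓ : Level} (F : CommutativeRing c ℓ) where
  open CommutativeRing F hiding (zero)
  open import Algebra.Properties.Ring ring
    using (-‿distribˡ-*; -‿distribʳ-*; -‿involutive; -‿+-comm; -0#≈0#; ⁻¹-anti-homo‿-)
  open import Algebra.Solver.Ring.NaturalCoefficients.Default commutativeSemiring
  open SetoidReasoning setoid

  private
    V : ℕ → Set c
    V = Vect F
    variable
      m n : ℕ

  infix  4 _≋_
  infixl 6 _⊖_
  infixr 7 _·ᵥ_

  _≋_ : V n → V n → Set ℓ
  _≋_ = _≈ᵥ_ F

  _⊖_ : V n → V n → V n
  _⊖_ = _-ᵥ_ F

  _·ᵥ_ : Carrier → V n → V n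
  (a ·ᵥ u) i = a * u i

  ⟨_,_⟩ : V n → V n → Carrier
  ⟨_,_⟩ = dot F

  ‖_‖² : V n → Carrier
  ‖ u ‖² = ⟨ u , u ⟩

  dot-cong-* : {u u′ v v′ : V n} → (∀ i → u i * v i ≈ u′ i * v′ i) → ⟨ u , v ⟩ ≈ ⟨ u′ , v′ ⟩
  dot-cong-* {zero}  uv≈u′v′ = refl
  dot-cong-* {suc n} uv≈u′v′ = +-cong (uv≈u′v′ fzero) (dot-cong-* (uv≈u′v′ ∘ fsuc))

  dot-cong : {u u′ v v′ : V n} → u ≋ u′ → v ≋ v′ → ⟨ u , v ⟩ ≈ ⟨ u′ , v′ ⟩
  dot-cong u≋u′ v≋v′ = dot-cong-* (λ i → *-cong (u≋u′ i) (v≋v′ i))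

  dot-comm : (u v : V n) → ⟨ u , v ⟩ ≈ ⟨ v , u ⟩
  dot-comm u v = dot-cong-* (λ i → *-comm (u i) (v i))

  dot-+ˡ : (u w v : V n) → ⟨ (λ i → u i + w i) , v ⟩ ≈ ⟨ u , v ⟩ + ⟨ w , v ⟩
  dot-+ˡ {zero}  u w v = sym (+-identityʳ 0#)
  dot-+ˡ {suc n} u w v = trans (+-congˡ (dot-+ˡ (tail u) (tail w) (tail v)))
    (solve 5 (λ a b x U W → (a :+ b) :* x :+ (U :+ W) := (a :* x :+ U) :+ (b :* x :+ W)) refl
       (u fzero) (w fzero) (v fzero) ⟨ tail u , tail v ⟩ ⟨ tail w , tail v ⟩)

  dot-negˡ : (u v : V n) → ⟨ (λ i → - u i) , v ⟩ ≈ - ⟨ u , v ⟩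
  dot-negˡ {zero}  u v = sym -0#≈0#
  dot-negˡ {suc n} u v = trans (+-cong (sym (-‿distribˡ-* _ _)) (dot-negˡ (tail u) (tail v))) (-‿+-comm _ _)

  dot-*ˡ : (a : Carrier) (u v : V n) → ⟨ a ·ᵥ u , v ⟩ ≈ a * ⟨ u , v ⟩
  dot-*ˡ {zero}  a u v = sym (zeroʳ a)
  dot-*ˡ {suc n} a u v = trans (+-cong (*-assoc _ _ _) (dot-*ˡ a (tail u) (tail v))) (sym (distribˡ a _ _))

  dot-*ʳ : (a : Carrier) (u v : V n) → ⟨ u , a ·ᵥ v ⟩ ≈ a * ⟨ u , v ⟩
  dot-*ʳ a u v = trans (dot-comm u _) (trans (dot-*ˡ a v u) (*-congˡ (dot-comm v u)))

  dot-subˡ : (u w v : V n) → ⟨ u ⊖ w , v ⟩ ≈ ⟨ u , v ⟩ - ⟨ w , v ⟩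
  dot-subˡ u w v = trans (dot-+ˡ u (λ i → - w i) v) (+-congˡ (dot-negˡ w v))

  dot-subʳ : (u v w : V n) → ⟨ u , v ⊖ w ⟩ ≈ ⟨ u , v ⟩ - ⟨ u , w ⟩
  dot-subʳ u v w =
    trans (dot-comm u _) (trans (dot-subˡ v w u) (+-cong (dot-comm v u) (-‿cong (dot-comm w u))))

  dot-tail : {u v : V (suc n)} → u fzero ≈ 0# → ⟨ u , v ⟩ ≈ ⟨ tail u , tail v ⟩
  dot-tail u₀≈0 = trans (+-congʳ (trans (*-congʳ u₀≈0) (zeroˡ _))) (+-identityˡ _)

  dot-zeroˡ : {u v : V n} → (∀ i → u i ≈ 0#) → ⟨ u , v ⟩ ≈ 0#
  dot-zeroˡ {zero}          u≈0 = refl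
  dot-zeroˡ {suc n} {u} {v} u≈0 = trans (dot-tail {u = u} {v} (u≈0 fzero)) (dot-zeroˡ (u≈0 ∘ fsuc))

  dot-++ : (u v : V m) (u′ v′ : V n) → ⟨ u ++ u′ , v ++ v′ ⟩ ≈ ⟨ u , v ⟩ + ⟨ u′ , v′ ⟩
  dot-++ {zero}  u v u′ v′ = sym (+-identityˡ _)
  dot-++ {suc m} u v u′ v′ = begin
    u fzero * v fzero + ⟨ tail (u ++ u′) , tail (v ++ v′) ⟩
      ≈⟨ +-congˡ (dot-cong (reflexive ∘ tail-++ u u′) (reflexive ∘ tail-++ v v′)) ⟩
    u fzero * v fzero + ⟨ tail u ++ u′ , tail v ++ v′ ⟩
      ≈⟨ +-congˡ (dot-++ (tail u) (tail v) u′ v′) ⟩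
    u fzero * v fzero + (⟨ tail u , tail v ⟩ + ⟨ u′ , v′ ⟩)
      ≈⟨ +-assoc _ _ _ ⟨
    ⟨ u , v ⟩ + ⟨ u′ , v′ ⟩
      ∎

  [x-z]-[y-z]≈x-y : ∀ x y z → (x - z) - (y - z) ≈ x - y
  [x-z]-[y-z]≈x-y x y z = begin
    (x - z) - (y - z)      ≈⟨ +-congˡ (⁻¹-anti-homo‿- y z) ⟩
    (x + - z) + (z + - y)  ≈⟨ solve 4 (λ x -z z -y → (x :+ -z) :+ (z :+ -y) := (x :+ -y) :+ (-z :+ z)) refl
                                x (- z) z (- y) ⟩
    (x - y) + (- z + z)    ≈⟨ +-congˡ (-‿inverseˡ z) ⟩
    (x - y) + 0#           ≈⟨ +-identityʳ _ ⟩
    x - y                  ∎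

  -x*-y≈x*y : ∀ x y → - x * - y ≈ x * y
  -x*-y≈x*y x y = trans (sym (-‿distribˡ-* x (- y))) (trans (-‿cong (sym (-‿distribʳ-* x y))) (-‿involutive _))

  dot-angle : (p x y : V n) → ⟨ p ⊖ x , y ⊖ x ⟩ ≈ ‖ x ⊖ p ‖² - ⟨ x ⊖ p , y ⊖ p ⟩
  dot-angle p x y = begin
    ⟨ p ⊖ x , y ⊖ x ⟩              ≈⟨ dot-cong-* (λ i → trans (*-cong (sym (⁻¹-anti-homo‿- (x i) (p i)))
                                                                     (sym (⁻¹-anti-homo‿- (x i) (y i))))
                                                             (-x*-y≈x*y _ _)) ⟩
    ⟨ x ⊖ p , x ⊖ y ⟩              ≈⟨ dot-cong {u = x ⊖ p} (λ _ → refl)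
                                                (λ i → [x-z]-[y-z]≈x-y (x i) (y i) (p i)) ⟨
    ⟨ x ⊖ p , (x ⊖ p) ⊖ (y ⊖ p) ⟩  ≈⟨ dot-subʳ (x ⊖ p) (x ⊖ p) (y ⊖ p) ⟩
    ‖ x ⊖ p ‖² - ⟨ x ⊖ p , y ⊖ p ⟩ ∎

  polarization : (u w : V n) → ‖ u ⊖ w ‖² ≈ ‖ u ‖² + ‖ w ‖² - (⟨ u , w ⟩ + ⟨ u , w ⟩)
  polarization u w = begin
    ‖ u ⊖ w ‖²                     ≈⟨ dot-subˡ u w (u ⊖ w) ⟩
    ⟨ u , u ⊖ w ⟩ - ⟨ w , u ⊖ w ⟩  ≈⟨ +-cong (dot-subʳ u u w)
                                              (-‿cong (trans (dot-subʳ w u w) (+-congʳ (dot-comm w u)))) ⟩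
    (a - e) - (e - b)              ≈⟨ +-congˡ (⁻¹-anti-homo‿- e b) ⟩
    (a + - e) + (b + - e)          ≈⟨ solve 4 (λ a -e b -e′ → (a :+ -e) :+ (b :+ -e′) := (a :+ b) :+ (-e :+ -e′))
                                              refl a (- e) b (- e) ⟩
    (a + b) + (- e + - e)          ≈⟨ +-congˡ (-‿+-comm e e) ⟩
    a + b - (e + e)                ∎
    where
    a = ‖ u ‖²
    b = ‖ w ‖²
    e = ⟨ u , w ⟩

  isotropic-triangle : {u w : V n} → ‖ u ‖² ≈ 0# → ‖ w ‖² ≈ 0# → ‖ u ⊖ w ‖² ≈ 0# →
                       ⟨ u , w ⟩ + ⟨ u , w ⟩ ≈ 0#
  isotropic-triangle {u = u} {w} ‖u‖²≈0 ‖w‖²≈0 ‖u⊖w‖²≈0 = begin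
    e + e          ≈⟨ -‿involutive (e + e) ⟨
    - (- (e + e))  ≈⟨ -‿cong -[e+e]≈0 ⟩
    - 0#           ≈⟨ -0#≈0# ⟩
    0#             ∎
    where
    e = ⟨ u , w ⟩
    -[e+e]≈0 : - (e + e) ≈ 0#
    -[e+e]≈0 = begin
      - (e + e)                  ≈⟨ trans (+-congʳ (+-identityˡ 0#)) (+-identityˡ _) ⟨
      0# + 0# - (e + e)          ≈⟨ +-congʳ (+-cong ‖u‖²≈0 ‖w‖²≈0) ⟨
      ‖ u ‖² + ‖ w ‖² - (e + e)  ≈⟨ polarization u w ⟨
      ‖ u ⊖ w ‖²                 ≈⟨ ‖u⊖w‖²≈0 ⟩
      0#                         ∎

module Polynomials {c ℓ : Level} (F : CommutativeRing c ℓ) where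
  open CommutativeRing F hiding (zero)
  open Vectors F
  open import Algebra.Properties.Ring ring using (x≈y⇒x∙y⁻¹≈ε)
  open import Algebra.Solver.Ring.NaturalCoefficients.Default commutativeSemiring
  open SetoidReasoning setoid

  private
    V : ℕ → Set c
    V = Vect F
    variable
      n d : ℕ

  -- Poly n d: polynomials of degree ≤ d in x₀ … xₙ₋₁.  One of degree ≤ d + 1 in
  -- n + 1 variables is uniquely g + x₀ · h with g free of x₀ and deg h ≤ d, which
  -- is the recursion defining polyDim.
  infixl 6 _+x₀*_
  data Poly : ℕ → ℕ → Set c where
    const₀ : Carrier → Poly zero d
    const₊ : Carrier → Poly (suc n) zero
    _+x₀*_ : Poly n (suc d) → Poly (suc n) d → Poly (suc n) (suc d)

  eval : Poly n d → V n → Carrier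
  eval (const₀ a) y = a
  eval (const₊ a) y = a
  eval (g +x₀* h) y = eval g (tail y) + y fzero * eval h y

  constant : Carrier → Poly n d
  embed : Poly n (suc d) → Poly (suc n) (suc d)

  constant {zero}          a = const₀ a
  constant {suc n} {zero}  a = const₊ a
  constant {suc n} {suc d} a = embed (constant a)

  embed g = g +x₀* constant 0#

  eval-constant : ∀ a (y : V n) → eval (constant {n} {d} a) y ≈ a
  eval-embed : (g : Poly n (suc d)) (y : V (suc n)) → eval (embed g) y ≈ eval g (tail y)

  eval-constant {zero}          a y = refl
  eval-constant {suc n} {zero}  a y = refl
  eval-constant {suc n} {suc d} a y = trans (eval-embed (constant a) y) (eval-constant a (tail y))

  eval-embed {d = d} g y =
    trans (+-congˡ (trans (*-congˡ (eval-constant {d = d} 0# y)) (zeroʳ _))) (+-identityʳ _)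

  infixl 6 _+ᴾ_
  _+ᴾ_ : Poly n d → Poly n d → Poly n d
  const₀ a   +ᴾ const₀ b     = const₀ (a + b)
  const₊ a   +ᴾ const₊ b     = const₊ (a + b)
  (g +x₀* h) +ᴾ (g′ +x₀* h′) = (g +ᴾ g′) +x₀* (h +ᴾ h′)

  eval-+ᴾ : (p q : Poly n d) (y : V n) → eval (p +ᴾ q) y ≈ eval p y + eval q y
  eval-+ᴾ (const₀ a) (const₀ b)   y = refl
  eval-+ᴾ (const₊ a) (const₊ b)   y = refl
  eval-+ᴾ (g +x₀* h) (g′ +x₀* h′) y = trans
    (+-cong (eval-+ᴾ g g′ (tail y)) (*-congˡ (eval-+ᴾ h h′ y)))
    (solve 5 (λ G G′ x H H′ → (G :+ G′) :+ x :* (H :+ H′) := (G :+ x :* H) :+ (G′ :+ x :* H′)) refl _ _ _ _ _)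

  infixr 7 _·ᴾ_
  _·ᴾ_ : Carrier → Poly n d → Poly n d
  a ·ᴾ const₀ b   = const₀ (a * b)
  a ·ᴾ const₊ b   = const₊ (a * b)
  a ·ᴾ (g +x₀* h) = a ·ᴾ g +x₀* a ·ᴾ h

  eval-·ᴾ : ∀ a (p : Poly n d) (y : V n) → eval (a ·ᴾ p) y ≈ a * eval p y
  eval-·ᴾ a (const₀ b) y = refl
  eval-·ᴾ a (const₊ b) y = refl
  eval-·ᴾ a (g +x₀* h) y = trans
    (+-cong (eval-·ᴾ a g (tail y)) (*-congˡ (eval-·ᴾ a h y)))
    (solve 4 (λ a G x H → a :* G :+ x :* (a :* H) := a :* (G :+ x :* H)) refl _ _ _ _)

  affine* : V n → Carrier → Poly n d → Poly n (suc d)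
  affine* u a (const₀ b) = const₀ (a * b)
  affine* u a (const₊ b) = affine* (tail u) a (constant b) +x₀* const₊ (u fzero * b)
  affine* u a (g +x₀* h) = affine* (tail u) a g +x₀* (u fzero ·ᴾ embed g +ᴾ affine* u a h)

  eval-affine* : ∀ (u : V n) a (p : Poly n d) y → eval (affine* u a p) y ≈ (⟨ u , y ⟩ + a) * eval p y
  eval-affine* u a (const₀ b) y = *-congʳ (sym (+-identityˡ a))
  eval-affine* u a (const₊ b) y = begin
    eval (affine* (tail u) a (constant b)) (tail y) + y fzero * (u fzero * b)
      ≈⟨ +-congʳ (trans (eval-affine* (tail u) a (constant b) (tail y)) (*-congˡ (eval-constant b (tail y)))) ⟩
    (⟨ tail u , tail y ⟩ + a) * b + y fzero * (u fzero * b)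
      ≈⟨ solve 5 (λ D a b x u₀ → (D :+ a) :* b :+ x :* (u₀ :* b) := (u₀ :* x :+ D :+ a) :* b) refl _ _ _ _ _ ⟩
    (⟨ u , y ⟩ + a) * b
      ∎
  eval-affine* u a (g +x₀* h) y = begin
    eval (affine* (tail u) a g) (tail y) + y fzero * eval (u fzero ·ᴾ embed g +ᴾ affine* u a h) y
      ≈⟨ +-cong (eval-affine* (tail u) a g (tail y))
                (*-congˡ (trans (eval-+ᴾ (u fzero ·ᴾ embed g) (affine* u a h) y)
                                (+-cong (trans (eval-·ᴾ (u fzero) (embed g) y) (*-congˡ (eval-embed g y)))
                                        (eval-affine* u a h y)))) ⟩
    (D + a) * G + y fzero * (u fzero * G + (u fzero * y fzero + D + a) * H)
      ≈⟨ solve 6 (λ D a G x u₀ H → (D :+ a) :* G :+ x :* (u₀ :* G :+ (u₀ :* x :+ D :+ a) :* H)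
                                 := (u₀ :* x :+ D :+ a) :* (G :+ x :* H)) refl _ _ _ _ _ _ ⟩
    (⟨ u , y ⟩ + a) * eval (g +x₀* h) y
      ∎
    where
    D = ⟨ tail u , tail y ⟩
    G = eval g (tail y)
    H = eval h y

  coefficients : Poly n d → V (polyDim n d)
  coefficients (const₀ a) _ = a
  coefficients (const₊ a) _ = a
  coefficients (g +x₀* h)   = coefficients g ++ coefficients h

  monomials : ∀ d → V n → V (polyDim n d)
  monomials {zero}  d       y _ = 1#
  monomials {suc n} zero    y _ = 1#
  monomials {suc n} (suc d) y   = monomials (suc d) (tail y) ++ y fzero ·ᵥ monomials d y

  eval≈dot : (p : Poly n d) (y : V n) → eval p y ≈ ⟨ coefficients p , monomials d y ⟩
  eval≈dot (const₀ a) y = sym (trans (+-identityʳ _) (*-identityʳ a))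
  eval≈dot (const₊ a) y = sym (trans (+-identityʳ _) (*-identityʳ a))
  eval≈dot {d = suc d} (g +x₀* h) y = sym (begin
    ⟨ coefficients g ++ coefficients h , monomials (suc d) (tail y) ++ y fzero ·ᵥ monomials d y ⟩
      ≈⟨ dot-++ (coefficients g) (monomials (suc d) (tail y)) (coefficients h) (y fzero ·ᵥ monomials d y) ⟩
    ⟨ coefficients g , monomials (suc d) (tail y) ⟩ + ⟨ coefficients h , y fzero ·ᵥ monomials d y ⟩
      ≈⟨ +-cong (sym (eval≈dot g (tail y)))
                (trans (dot-*ʳ (y fzero) (coefficients h) (monomials d y)) (*-congˡ (sym (eval≈dot h y)))) ⟩
    eval (g +x₀* h) y
      ∎)

  vanishOn : List Carrier → Carrier → Carrier
  vanishOn []       t = 1#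
  vanishOn (s ∷ ss) t = (t - s) * vanishOn ss t

  vanishOn-cong : ∀ ss {t t′} → t ≈ t′ → vanishOn ss t ≈ vanishOn ss t′
  vanishOn-cong []       t≈t′ = refl
  vanishOn-cong (s ∷ ss) t≈t′ = *-cong (+-congʳ t≈t′) (vanishOn-cong ss t≈t′)

  vanishOn-root : ∀ {ss t} → Any (t ≈_) ss → vanishOn ss t ≈ 0#
  vanishOn-root (here t≈s)   = trans (*-congʳ (x≈y⇒x∙y⁻¹≈ε t≈s)) (zeroˡ _)
  vanishOn-root (there t∈ss) = trans (*-congˡ (vanishOn-root t∈ss)) (zeroʳ _)

  vanishOnAffine : (ss : List Carrier) → V n → Carrier → Poly n (length ss)
  vanishOnAffine []       u a = constant 1#
  vanishOnAffine (s ∷ ss) u a = affine* u (a - s) (vanishOnAffine ss u a)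

  eval-vanishOnAffine : ∀ ss (u : V n) a y → eval (vanishOnAffine ss u a) y ≈ vanishOn ss (⟨ u , y ⟩ + a)
  eval-vanishOnAffine []       u a y = eval-constant 1# y
  eval-vanishOnAffine (s ∷ ss) u a y = trans (eval-affine* u (a - s) (vanishOnAffine ss u a) y)
    (*-cong (sym (+-assoc _ _ _)) (eval-vanishOnAffine ss u a y))

module FieldTheory {c ℓ : Level} (F : CommutativeRing c ℓ) (isField : IsField F) where
  open CommutativeRing F hiding (zero)
  open Vectors F
  open Polynomials F
  open import Algebra.Properties.Ring ring using (x∙y⁻¹≈ε⇒x≈y; x≈y⇒x∙y⁻¹≈ε; -0#≈0#; +-cancelˡ)
  open SetoidReasoning setoid

  private
    V : ℕ → Set c
    V = Vect F
    variable
      m m′ N N′ : ℕ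

  0≉1 : ¬ 0# ≈ 1#
  0≉1 = proj₁ isField

  x*y≈0⇒y≈0 : ∀ {x y} → ¬ x ≈ 0# → x * y ≈ 0# → y ≈ 0#
  x*y≈0⇒y≈0 {x} {y} x≉0 xy≈0 with x⁻¹ , xx⁻¹≈1 ← proj₂ isField x x≉0 = begin
    y              ≈⟨ *-identityˡ y ⟨
    1# * y         ≈⟨ *-congʳ (trans (*-comm x⁻¹ x) xx⁻¹≈1) ⟨
    (x⁻¹ * x) * y  ≈⟨ *-assoc x⁻¹ x y ⟩
    x⁻¹ * (x * y)  ≈⟨ *-congˡ xy≈0 ⟩
    x⁻¹ * 0#       ≈⟨ zeroʳ x⁻¹ ⟩
    0#             ∎

  *-nonzero : ∀ {x y} → ¬ x ≈ 0# → ¬ y ≈ 0# → ¬ x * y ≈ 0#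
  *-nonzero x≉0 y≉0 = y≉0 ∘ x*y≈0⇒y≈0 x≉0

  x+x≈0⇒x≈0 : ¬ 1# + 1# ≈ 0# → ∀ {x} → x + x ≈ 0# → x ≈ 0#
  x+x≈0⇒x≈0 1+1≉0 {x} x+x≈0 = x*y≈0⇒y≈0 1+1≉0 (begin
    (1# + 1#) * x    ≈⟨ distribʳ x 1# 1# ⟩
    1# * x + 1# * x  ≈⟨ +-cong (*-identityˡ x) (*-identityˡ x) ⟩
    x + x            ≈⟨ x+x≈0 ⟩
    0#               ∎)

  vanishOn-nonzero : ∀ {ss t} → All (λ s → ¬ t ≈ s) ss → ¬ vanishOn ss t ≈ 0#
  vanishOn-nonzero []           = 0≉1 ∘ sym
  vanishOn-nonzero (t≉s ∷ t≉ss) = *-nonzero (t≉s ∘ x∙y⁻¹≈ε⇒x≈y _ _) (vanishOn-nonzero t≉ss)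

  -- x ↦ x + 1 would be a fixpoint-free involution, pairing off the elements.
  odd-order⇒1+1≉0 : ∀ {xs} → AllPairs _≉_ xs → (∀ x → Any (x ≈_) xs) → length xs % 2 ≡ 1 →
                    ¬ 1# + 1# ≈ 0#
  odd-order⇒1+1≉0 {xs} xs-unique xs-covers odd 1+1≈0 = contradiction (≡.trans (≡.sym even) odd) λ ()
    where
    +1+1≈id : ∀ x → x + 1# + 1# ≈ x
    +1+1≈id x = trans (+-assoc x 1# 1#) (trans (+-congˡ 1+1≈0) (+-identityʳ x))
    +1≉id : ∀ x → ¬ x + 1# ≈ x
    +1≉id x x+1≈x = 0≉1 (sym (+-cancelˡ x 1# 0# (trans x+1≈x (sym (+-identityʳ x)))))
    even : length xs % 2 ≡ 0
    even with m , |xs|≡m*2 ← σ-closed⇒even setoid (enumeration⇒decidable setoid xs-unique xs-covers)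
                               +-congʳ +1+1≈id +1≉id (length xs) xs ≡.refl xs-unique (λ {x} _ → xs-covers (x + 1#))
      = ≡.trans (≡.cong (_% 2) |xs|≡m*2) (m*n%n≡0 m 2)

  Biorthogonal : (r c : Fin m → V N) → Set ℓ
  Biorthogonal r c = (∀ i j → i ≢ j → ⟨ r i , c j ⟩ ≈ 0#) × (∀ i → ¬ ⟨ r i , c i ⟩ ≈ 0#)

  biorthogonal-reindex : {r c : Fin m → V N} (r′ c′ : Fin m′ → V N′) (e : Fin m′ → Fin m) →
                         (∀ k l → e k ≡ e l → k ≡ l) →
                         (∀ k l → ⟨ r′ k , c′ l ⟩ ≈ ⟨ r (e k) , c (e l) ⟩) →
                         Biorthogonal r c → Biorthogonal r′ c′
  biorthogonal-reindex r′ c′ e e-injective same (off , diag) =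
    (λ k l k≢l → trans (same k l) (off (e k) (e l) (k≢l ∘ e-injective k l))) ,
    (λ k → diag (e k) ∘ trans (sym (same k k)))

  module _ (_≟_ : ∀ x y → Dec (x ≈ y)) where

    -- Gaussian elimination on the first coordinate.
    biorthogonal⇒≤ : (r c : Fin m → V N) → Biorthogonal r c → m ≤ N
    biorthogonal⇒≤ {zero}          r c _          = z≤n
    biorthogonal⇒≤ {suc m} {zero}  r c (_ , diag) = contradiction refl (diag fzero)
    biorthogonal⇒≤ {suc m} {suc N} r c bo@(off , _) with any? (λ i → ¬? (r i fzero ≟ 0#))
    ... | no no-pivot = m≤n⇒m≤1+n (biorthogonal⇒≤ (tail ∘ r) (tail ∘ c)
          (biorthogonal-reindex {r = r} {c} (tail ∘ r) (tail ∘ c) id (λ _ _ → id)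
             (λ k l → sym (dot-tail {u = r k} {c l} (zero-column k))) bo))
      where
      zero-column : ∀ i → r i fzero ≈ 0#
      zero-column i = decidable-stable (r i fzero ≟ 0#) (no-pivot ∘ (i ,_))
    ... | yes (i₀ , pivot≉0) = s≤s (biorthogonal⇒≤ (tail ∘ eliminate) (tail ∘ c ∘ punchIn i₀)
          (biorthogonal-reindex {r = r} {c} (tail ∘ eliminate) (tail ∘ c ∘ punchIn i₀)
             (punchIn i₀) (punchIn-injective i₀) same bo))
      where
      pivot⁻¹ : Carrier
      pivot⁻¹ = proj₁ (proj₂ isField _ pivot≉0)
      pivot*pivot⁻¹≈1 : r i₀ fzero * pivot⁻¹ ≈ 1#
      pivot*pivot⁻¹≈1 = proj₂ (proj₂ isField _ pivot≉0)
      factor : Fin m → Carrier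
      factor k = r (punchIn i₀ k) fzero * pivot⁻¹
      eliminate : Fin m → V (suc N)
      eliminate k = r (punchIn i₀ k) ⊖ factor k ·ᵥ r i₀
      eliminate-head : ∀ k → eliminate k fzero ≈ 0#
      eliminate-head k = x≈y⇒x∙y⁻¹≈ε (begin
        r (punchIn i₀ k) fzero                            ≈⟨ *-identityʳ _ ⟨
        r (punchIn i₀ k) fzero * 1#                       ≈⟨ *-congˡ (trans (*-comm _ _) pivot*pivot⁻¹≈1) ⟨
        r (punchIn i₀ k) fzero * (pivot⁻¹ * r i₀ fzero)   ≈⟨ *-assoc _ _ _ ⟨
        factor k * r i₀ fzero                             ∎)
      same : ∀ k l → ⟨ tail (eliminate k) , tail (c (punchIn i₀ l)) ⟩
                     ≈ ⟨ r (punchIn i₀ k) , c (punchIn i₀ l) ⟩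
      same k l = begin
        ⟨ tail (eliminate k) , tail (c l′) ⟩
          ≈⟨ dot-tail {u = eliminate k} {c l′} (eliminate-head k) ⟨
        ⟨ r k′ ⊖ factor k ·ᵥ r i₀ , c l′ ⟩
          ≈⟨ dot-subˡ (r k′) (factor k ·ᵥ r i₀) (c l′) ⟩
        ⟨ r k′ , c l′ ⟩ - ⟨ factor k ·ᵥ r i₀ , c l′ ⟩
          ≈⟨ +-congˡ (-‿cong (trans (dot-*ˡ (factor k) (r i₀) (c l′))
                                    (*-congˡ (off i₀ l′ (punchInᵢ≢i i₀ l ∘ ≡.sym))))) ⟩
        ⟨ r k′ , c l′ ⟩ - factor k * 0#
          ≈⟨ +-congˡ (trans (-‿cong (zeroʳ _)) -0#≈0#) ⟩
        ⟨ r k′ , c l′ ⟩ + 0#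
          ≈⟨ +-identityʳ _ ⟩
        ⟨ r k′ , c l′ ⟩
          ∎
        where
        k′ = punchIn i₀ k
        l′ = punchIn i₀ l

module RightAngleFree {c ℓ : Level} (F : CommutativeRing c ℓ) (isField : IsField F) where
  open CommutativeRing F hiding (zero)
  open Vectors F
  open Polynomials F
  open FieldTheory F isField
  open SetoidMembership setoid using () renaming (_∈_ to _∈ₛ_)
  open import Algebra.Properties.Ring ring using (x≈y⇒x∙y⁻¹≈ε)

  module _ (xs : List Carrier) (xs-unique : AllPairs _≉_ xs) (xs-covers : ∀ x → x ∈ₛ xs)
           (1+1≉0 : ¬ 1# + 1# ≈ 0#)
           {n : ℕ} (A : List (Vect F n)) (A-unique : AllPairs (λ u v → ¬ u ≋ v) A)
           (no-right-angle : ∀ x y z → x ∈ A → y ∈ A → z ∈ A → ¬ x ≋ y → ¬ x ≋ z → ¬ y ≋ z →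
                             ¬ ⟨ x ⊖ z , y ⊖ z ⟩ ≈ 0#) where

    private
      q : ℕ
      q = length xs

      D : ℕ
      D = polyDim n (q ∸ 2)

      _≟_ : ∀ x y → Dec (x ≈ y)
      _≟_ = enumeration⇒decidable setoid xs-unique xs-covers

      _≟ᵥ_ : ∀ (x y : Vect F n) → Dec (x ≋ y)
      x ≟ᵥ y = all? (λ i → x i ≟ y i)

      ≋-sym : {x y : Vect F n} → ¬ x ≋ y → ¬ y ≋ x
      ≋-sym x≉y y≈x = x≉y (sym ∘ y≈x)

      ≉-resp : ∀ {a x y} → x ≈ y → ¬ a ≈ x → ¬ a ≈ y
      ≉-resp x≈y a≉x = a≉x ∘ flip trans (sym x≈y)

    nonzeroExcept : Carrier → List Carrier
    nonzeroExcept a = filter (∁? (0# ≟_)) (filter (∁? (a ≟_)) xs)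

    nonzeroExcept-complete : ∀ {a t} → ¬ t ≈ 0# → ¬ t ≈ a → t ∈ₛ nonzeroExcept a
    nonzeroExcept-complete t≉0 t≉a =
      ∈-filter⁺ setoid (∁? (0# ≟_)) ≉-resp
        (∈-filter⁺ setoid (∁? (_ ≟_)) ≉-resp (xs-covers _) (t≉a ∘ sym)) (t≉0 ∘ sym)

    nonzeroExcept-sound : ∀ a → All (λ s → ¬ a ≈ s) (nonzeroExcept a)
    nonzeroExcept-sound a = All-filter⁺ (∁? (0# ≟_)) (all-filter (∁? (a ≟_)) xs)

    length-nonzeroExcept : ∀ {a} → ¬ a ≈ 0# → length (nonzeroExcept a) ≤ q ∸ 2
    length-nonzeroExcept {a} a≉0 = ∸-monoˡ-≤ 2 (≤-trans (s≤s without-0) without-a)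
      where
      without-a : length (filter (∁? (a ≟_)) xs) < q
      without-a = filter-notAll (∁? (a ≟_)) xs (Any.map (λ a≈s a≉s → a≉s a≈s) (xs-covers a))
      without-0 : length (nonzeroExcept a) < length (filter (∁? (a ≟_)) xs)
      without-0 = filter-notAll (∁? (0# ≟_)) _
        (Any.map (λ 0≈s 0≉s → 0≉s 0≈s) (∈-filter⁺ setoid (∁? (a ≟_)) ≉-resp (xs-covers 0#) a≉0))

    sphere-bound : ∀ {a p} → ¬ a ≈ 0# → p ∈ A → (B : List (Vect F n)) → AllPairs (λ u v → ¬ u ≋ v) B →
                   All (λ x → x ∈ A × ¬ x ≋ p × ‖ x ⊖ p ‖² ≈ a) B → length B ≤ D
    sphere-bound {a} {p} a≉0 p∈A B B-unique B-sphere =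
      ≤-trans (biorthogonal⇒≤ _≟_ row column (off-diagonal , diagonal)) (polyDim-mono n (length-nonzeroExcept a≉0))
      where
      L = nonzeroExcept a
      b v : Fin (length B) → Vect F n
      b = lookup B
      v i = b i ⊖ p
      row column : Fin (length B) → Vect F (polyDim n (length L))
      row i = coefficients (vanishOnAffine L (v i) (- ⟨ v i , p ⟩))
      column j = monomials (length L) (b j)
      row·column : ∀ i j → ⟨ row i , column j ⟩ ≈ vanishOn L ⟨ v i , v j ⟩
      row·column i j = begin
        ⟨ row i , column j ⟩                                 ≈⟨ eval≈dot (vanishOnAffine L (v i) _) (b j) ⟨
        eval (vanishOnAffine L (v i) (- ⟨ v i , p ⟩)) (b j)  ≈⟨ eval-vanishOnAffine L (v i) _ (b j) ⟩
        vanishOn L (⟨ v i , b j ⟩ - ⟨ v i , p ⟩)             ≈⟨ vanishOn-cong L (dot-subʳ (v i) (b j) p) ⟨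
        vanishOn L ⟨ v i , v j ⟩                             ∎
        where open SetoidReasoning setoid
      b∈A : ∀ i → b i ∈ A
      b∈A i = proj₁ (All.lookup B-sphere (∈-lookup i))
      b≉p : ∀ i → ¬ b i ≋ p
      b≉p i = proj₁ (proj₂ (All.lookup B-sphere (∈-lookup i)))
      ‖v‖²≈a : ∀ i → ‖ v i ‖² ≈ a
      ‖v‖²≈a i = proj₂ (proj₂ (All.lookup B-sphere (∈-lookup i)))
      diagonal : ∀ i → ¬ ⟨ row i , column i ⟩ ≈ 0#
      diagonal i = vanishOn-nonzero (nonzeroExcept-sound a)
                 ∘ trans (vanishOn-cong L (sym (‖v‖²≈a i))) ∘ trans (sym (row·column i i))
      -- ⟨vᵢ, vⱼ⟩ ∉ {0, a}: otherwise the angle at p, resp. at bᵢ, would be right.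
      off-diagonal : ∀ i j → i ≢ j → ⟨ row i , column j ⟩ ≈ 0#
      off-diagonal i j i≢j = trans (row·column i j) (vanishOn-root (nonzeroExcept-complete t≉0 t≉a))
        where
        t = ⟨ v i , v j ⟩
        bᵢ≉bⱼ : ¬ b i ≋ b j
        bᵢ≉bⱼ = allPairs-lookup ≋-sym B-unique i j i≢j
        t≉0 : ¬ t ≈ 0#
        t≉0 = no-right-angle (b i) (b j) p (b∈A i) (b∈A j) p∈A bᵢ≉bⱼ (b≉p i) (b≉p j)
        t≉a : ¬ t ≈ a
        t≉a t≈a = no-right-angle p (b j) (b i) p∈A (b∈A j) (b∈A i)
                    (≋-sym (b≉p j)) (≋-sym (b≉p i)) (≋-sym bᵢ≉bⱼ) (begin
            ⟨ p ⊖ b i , b j ⊖ b i ⟩  ≈⟨ dot-angle p (b i) (b j) ⟩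
            ‖ v i ‖² - t             ≈⟨ +-cong (‖v‖²≈a i) (-‿cong t≈a) ⟩
            a - a                    ≈⟨ -‿inverseʳ a ⟩
            0#                       ∎)
          where open SetoidReasoning setoid

    nullCone-bound : ∀ {z} → z ∈ A → (B : List (Vect F n)) → AllPairs (λ u v → ¬ u ≋ v) B →
                     All (λ x → x ∈ A × ‖ x ⊖ z ‖² ≈ 0#) B → length B ≤ 2 ℕ.+ q ℕ.* D
    nullCone-bound {z} z∈A B B-unique B-cone with Any.any? (λ x → ¬? (x ≟ᵥ z)) B
    ... | no all≋z = ≤-trans
          (length≤1 (≋-setoid setoid n) B-unique
             (All.map (λ {x} → decidable-stable (x ≟ᵥ z)) (¬Any⇒All¬ B all≋z)))
          (s≤s z≤n)
    ... | yes some≉z with z′ , z′∈B , z′≉z ← find some≉z = begin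
      length B                                ≡⟨ length-filter-∁ near? B ⟩
      length (filter near? B) ℕ.+ length far  ≤⟨ +-mono-≤ near-bound far-bound ⟩
      2 ℕ.+ q ℕ.* D           ∎
      where
      open ≤-Reasoning
      z′∈A : z′ ∈ A
      z′∈A = proj₁ (All.lookup B-cone z′∈B)
      near? : Decidable (λ x → Any (x ≋_) (z ∷ z′ ∷ []))
      near? x = Any.any? (x ≟ᵥ_) (z ∷ z′ ∷ [])
      far = filter (∁? near?) B
      near-bound : length (filter near? B) ≤ 2
      near-bound = length≤cover (λ c x → x ≟ᵥ c) (z ∷ z′ ∷ []) (filter near? B)
        (λ x∈ → proj₂ (∈-filter⁻ near? {xs = B} x∈))
        (λ c → length≤1 (≋-setoid setoid n) (AllPairs.filter⁺ (_≟ᵥ c) (AllPairs.filter⁺ near? B-unique))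
                                            (all-filter (_≟ᵥ c) (filter near? B)))
      -- x, z and z′ lie pairwise on isotropic lines, which forces a right angle at z.
      far-off-cone : ∀ {x} → x ∈ far → ¬ ‖ x ⊖ z′ ‖² ≈ 0#
      far-off-cone {x} x∈far ‖x⊖z′‖²≈0 with x∈B , x-far ← ∈-filter⁻ (∁? near?) x∈far =
        no-right-angle x z′ z (proj₁ (All.lookup B-cone x∈B)) z′∈A z∈A
          (x-far ∘ there ∘ here) (x-far ∘ here) z′≉z
          (x+x≈0⇒x≈0 1+1≉0 (isotropic-triangle {u = x ⊖ z} {z′ ⊖ z}
            (proj₂ (All.lookup B-cone x∈B)) (proj₂ (All.lookup B-cone z′∈B))
            (trans (dot-cong x⊖z′ x⊖z′) ‖x⊖z′‖²≈0)))
        where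
        x⊖z′ : (x ⊖ z) ⊖ (z′ ⊖ z) ≋ x ⊖ z′
        x⊖z′ i = [x-z]-[y-z]≈x-y (x i) (z′ i) (z i)
      level : Carrier → List (Vect F n)
      level s = filter (λ x → ‖ x ⊖ z′ ‖² ≟ s) far
      level-bound : ∀ s → length (level s) ≤ D
      level-bound s with s ≟ 0#
      ... | yes s≈0 = ≤-trans (≤-reflexive (≡.cong length (filter-none _ (All.tabulate λ x∈far →
                        far-off-cone x∈far ∘ flip trans s≈0)))) z≤n
      ... | no s≉0 = sphere-bound s≉0 z′∈A (level s) (AllPairs.filter⁺ _ (AllPairs.filter⁺ _ B-unique))
                       (All.tabulate on-sphere)
        where
        on-sphere : ∀ {x} → x ∈ level s → x ∈ A × ¬ x ≋ z′ × ‖ x ⊖ z′ ‖² ≈ s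
        on-sphere x∈ with x∈far , ‖x⊖z′‖²≈s ← ∈-filter⁻ _ x∈
                     with x∈B , x-far ← ∈-filter⁻ (∁? near?) x∈far =
          proj₁ (All.lookup B-cone x∈B) , x-far ∘ there ∘ here , ‖x⊖z′‖²≈s
      far-bound : length far ≤ q ℕ.* D
      far-bound =
        length≤cover (λ s x → ‖ x ⊖ z′ ‖² ≟ s) xs far (λ {x} _ → xs-covers ‖ x ⊖ z′ ‖²) level-bound

    centred-bound : ∀ {z} → z ∈ A → length A ≤ q ℕ.* (2 ℕ.+ q ℕ.* D)
    centred-bound {z} z∈A =
      length≤cover (λ a x → ‖ x ⊖ z ‖² ≟ a) xs A (λ {x} _ → xs-covers ‖ x ⊖ z ‖²) level-bound
      where
      instance
        q-nonZero : NonZero q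
        q-nonZero = >-nonZero (∈-length setoid (xs-covers 0#))
      level : Carrier → List (Vect F n)
      level a = filter (λ x → ‖ x ⊖ z ‖² ≟ a) A
      level-bound : ∀ a → length (level a) ≤ 2 ℕ.+ q ℕ.* D
      level-bound a with a ≟ 0#
      ... | yes a≈0 = nullCone-bound z∈A (level a) (AllPairs.filter⁺ _ A-unique) (All.tabulate on-cone)
        where
        on-cone : ∀ {x} → x ∈ level a → x ∈ A × ‖ x ⊖ z ‖² ≈ 0#
        on-cone x∈ with x∈A , ‖x⊖z‖²≈a ← ∈-filter⁻ _ x∈ = x∈A , trans ‖x⊖z‖²≈a a≈0
      ... | no a≉0 = ≤-trans
              (sphere-bound a≉0 z∈A (level a) (AllPairs.filter⁺ _ A-unique) (All.tabulate on-sphere))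
              (≤-trans (m≤n*m _ q) (m≤n+m _ 2))
        where
        on-sphere : ∀ {x} → x ∈ level a → x ∈ A × ¬ x ≋ z × ‖ x ⊖ z ‖² ≈ a
        on-sphere x∈ with x∈A , ‖x⊖z‖²≈a ← ∈-filter⁻ _ x∈ =
          x∈A , (λ x≋z → a≉0 (trans (sym ‖x⊖z‖²≈a) (dot-zeroˡ (x≈y⇒x∙y⁻¹≈ε ∘ x≋z)))) ,
          ‖x⊖z‖²≈a

    length-A : length A ≤ q ℕ.* (2 ℕ.+ q ℕ.* D)
    length-A = by-cases A ≡.refl
      where
      by-cases : ∀ ys → A ≡ ys → length A ≤ q ℕ.* (2 ℕ.+ q ℕ.* D)
      by-cases []      A≡[]  = ≤-trans (≤-reflexive (≡.cong length A≡[])) z≤n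
      by-cases (z ∷ _) A≡z∷_ = centred-bound (≡.subst (z ∈_) (≡.sym A≡z∷_) (here ≡.refl))

open import Data.Nat using (_+_; _*_)

2≤primePower : ∀ {q} → IsPrimePower q → 2 ≤ q
2≤primePower (p , suc k , p-prime , _ , ≡.refl) =
  ≤-trans (nonTrivial⇒n>1 p {{prime⇒nonTrivial p-prime}})
          (m≤m*n p (p ^ k) {{m^n≢0 p k {{prime⇒nonZero p-prime}}}})

q≤4[q∸1] : ∀ {q} → 2 ≤ q → q ≤ 4 * (q ∸ 1)
q≤4[q∸1] {suc zero}    (s≤s ())
q≤4[q∸1] {suc (suc r)} _ = ≤-trans (≤-reflexive (+-comm 1 (suc r))) (+-monoʳ-≤ (suc r) (s≤s z≤n))

q[2+qN]≤4[q∸1]qN+2q : ∀ {q} N → 2 ≤ q → q * (2 + q * N) ≤ 4 * (q ∸ 1) * q * N + 2 * q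
q[2+qN]≤4[q∸1]qN+2q {q} N 2≤q = begin
  q * (2 + q * N)              ≡⟨ expand q N ⟩
  q * q * N + 2 * q            ≤⟨ +-monoˡ-≤ (2 * q) (*-monoˡ-≤ N (*-monoˡ-≤ q (q≤4[q∸1] 2≤q))) ⟩
  4 * (q ∸ 1) * q * N + 2 * q  ∎
  where
  open ≤-Reasoning
  expand : ∀ q N → q * (2 + q * N) ≡ q * q * N + 2 * q
  expand = solve-∀

theorem1p2 : ∀ {c ℓ : Level} (F : CommutativeRing c ℓ) → IsField F →
    (q : ℕ) → IsPrimePower q → q % 2 ≡ 1 → HasCard F q →
    (n : ℕ) → 1 ≤ n →
    (A : List (Vect F n)) → AllPairs (λ u v → ¬ _≈ᵥ_ F u v) A →
    (∀ x y z → x ∈ A → y ∈ A → z ∈ A →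
      ¬ _≈ᵥ_ F x y → ¬ _≈ᵥ_ F x z → ¬ _≈ᵥ_ F y z →
      ¬ CommutativeRing._≈_ F (dot F (_-ᵥ_ F x z) (_-ᵥ_ F y z)) (CommutativeRing.0# F)) →
    length A ≤ 4 * (q ∸ 1) * q * ((n + q ∸ 2) C (q ∸ 2)) + 2 * q
theorem1p2 F isField q q-primePower q-odd (xs , ≡.refl , xs-unique , xs-covers) n _ A A-unique no-right-angle = begin
  length A                                           ≤⟨ length-A ⟩
  q * (2 + q * polyDim n (q ∸ 2))                    ≡⟨ ≡.cong (λ N → q * (2 + q * N)) (polyDim≡C n (q ∸ 2)) ⟩
  q * (2 + q * ((n + (q ∸ 2)) C (q ∸ 2)))            ≡⟨ ≡.cong (λ m → q * (2 + q * (m C (q ∸ 2)))) (+-∸-assoc n 2≤q) ⟨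
  q * (2 + q * ((n + q ∸ 2) C (q ∸ 2)))              ≤⟨ q[2+qN]≤4[q∸1]qN+2q _ 2≤q ⟩
  4 * (q ∸ 1) * q * ((n + q ∸ 2) C (q ∸ 2)) + 2 * q  ∎
  where
  open ≤-Reasoning
  2≤q = 2≤primePower q-primePower
  1+1≉0 = FieldTheory.odd-order⇒1+1≉0 F isField xs-unique xs-covers q-odd
  length-A = RightAngleFree.length-A F isField xs xs-unique xs-covers 1+1≉0 A A-unique no-right-angle
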